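{- (i) If $n\in\mathbb{N}$ with $10\le n\le 18$, then $\mathscr{S}_9(n)$ is full; $\mathscr{S}_9(19)$ is not full. (ii) Let $m\ge 10$ be an integer. If $n\in\mathbb{N}$ with $m<n\le m+6$, then $\mathscr{S}_m(n)$ is full; $\mathscr{S}_m(m+7)$ is not full.
   Context: $\mathbb{N}$ denotes the positive integers. For $m,n\in\mathbb{N}$, $\mathscr{S}_m(n)$ is the set of all $T\in\mathbb{Z}$ for which there exist $x_1,\ldots,x_m\in\mathbb{Z}$ with $x_1+\cdots+x_m=T$ and $x_1^2+\cdots+x_m^2=n$. Let $\mathscr{T}_m(n)=\{T\in\mathbb{Z}: n\equiv T \pmod 2,\ T^2<mn\}$ and $\mathscr{S}_m'(n)=\{T\in\mathscr{S}_m(n): T^2<mn\}$. $\mathscr{S}_m(n)$ is called full if $\mathscr{S}_m'(n)=\mathscr{T}_m(n)$. -}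

module Defs where

open import Data.Nat using (ℕ)
open import Data.Fin using (Fin)
open import Data.Integer using (ℤ; +_; _+_; _-_; _*_; _<_)
open import Data.Integer.Divisibility using (_∣_)
open import Data.Vec.Functional using (Vector; foldr)
open import Data.Product using (Σ; _×_; ∃)
open import Function.Bundles using (_⇔_)

sumℤ : ∀ {m} → Vector ℤ m → ℤ
sumℤ = foldr _+_ (+ 0)

sumSqℤ : ∀ {m} → Vector ℤ m → ℤ
sumSqℤ x = sumℤ (λ i → x i * x i)

InS : ℕ → ℕ → ℤ → Set
InS m n T = Σ (Vector ℤ m) (λ x → (sumℤ x ≡ T) × (sumSqℤ x ≡ + n))
  where open import Relation.Binary.PropositionalEquality using (_≡_)

InS' : ℕ → ℕ → ℤ → Set
InS' m n T = InS m n T × (T * T < + m * + n)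

InT : ℕ → ℕ → ℤ → Set
InT m n T = ((+ 2) ∣ (T - + n)) × (T * T < + m * + n)

Full : ℕ → ℕ → Set
Full m n = ∀ (T : ℤ) → InS' m n T ⇔ InT m n T

module Submission where

-- The
-- inclusion 𝒮'_m(n) ⊆ 𝒯_m(n) always holds because x ≡ x² (mod 2); both sets
-- are symmetric under T ↦ -T; so for m ≤ n fullness reduces to realizing the
-- nonnegative targets t, which then satisfy n = t + 2w (full-from-nonneg).
-- Conversely 3x ≤ x² + 2 gives 3T ≤ n + 2m on 𝒮_m(n), so a target of 𝒯_m(n)
-- beyond that bound refutes fullness (not-full).
--
-- The vector with j entries 2, a entries 1,
-- b entries -1 and zeros elsewhere has sum 2j + a - b and square sum
-- 4j + a + b; it realizes t when j ≤ w, 3j ≤ t + w and n ≤ m + 3j.  The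
-- first condition follows from t² < mn once (n - 2(j - 1))² ≥ mn, the second
-- once 6j ≤ n + 1.  One two covers m ≤ n ≤ m + 3, two twos cover
-- m + 4 ≤ n ≤ m + 6, and three twos cover 𝒮_9(16), 𝒮_9(17), 𝒮_9(18) except
-- the target 0 of 𝒮_9(16), realized by (2, 2, -2, -2, 0, …, 0).  Fullness
-- fails for the targets 13 of 𝒯_9(19) and m + 3 of 𝒯_m(m + 7).

module IntegerVectors where
  open import Defs
  open import Data.Nat as ℕ using (ℕ; zero; suc; z≤n; s≤s)
  import Data.Nat.Properties as ℕₚ
  open import Data.Integer
    using (ℤ; +_; -[1+_]; _+_; _-_; _*_; -_; _⊖_; _≤_; _<_; ∣_∣; +≤+; -≤+; +<+)
  import Data.Integer.Properties as ℤₚ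
  open import Data.Integer.DivMod using (_%_; _/_; n%d<d; a≡a%n+[a/n]*n)
  import Data.Integer.Divisibility as Unsigned
  open import Data.Integer.Divisibility.Signed
    using (divides; ∣m∣n⇒∣m+n; ∣m⇒∣-m; ∣n⇒∣m*n; ∣-refl; ∣⇒∣ᵤ; ∣ᵤ⇒∣)
    renaming (_∣_ to _∣ₛ_)
  open import Data.Integer.Tactic.RingSolver using (solve-∀)
  import Data.Nat.Tactic.RingSolver as ℕ-Solver
  open import Data.Vec.Functional using (Vector; []; _∷_; map; head; tail)
  open import Data.Product using (Σ; _×_; _,_; proj₁; proj₂)
  open import Data.Sum using (inj₁; inj₂)
  open import Data.Empty using (⊥-elim)
  open import Relation.Nullary using (¬_)
  open import Relation.Binary.PropositionalEquality
  open import Function.Bundles using (mk⇔; Equivalence)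

  twosOnes : (j a b m : ℕ) → Vector ℤ m
  twosOnes j       a       b       zero    = []
  twosOnes (suc j) a       b       (suc m) = + 2 ∷ twosOnes j a b m
  twosOnes zero    (suc a) b       (suc m) = + 1 ∷ twosOnes zero a b m
  twosOnes zero    zero    (suc b) (suc m) = -[1+ 0 ] ∷ twosOnes zero zero b m
  twosOnes zero    zero    zero    (suc m) = + 0 ∷ twosOnes zero zero zero m

  twosOnes-sum : ∀ j a b m → j ℕ.+ a ℕ.+ b ℕ.≤ m →
                 sumℤ (twosOnes j a b m) ≡ + (j ℕ.* 2 ℕ.+ a) - + b
  twosOnes-sum zero    zero    zero    zero    _       = refl
  twosOnes-sum zero    zero    zero    (suc m) _       =
    cong (_+_ (+ 0)) (twosOnes-sum zero zero zero m z≤n)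
  twosOnes-sum (suc j) a       b       (suc m) (s≤s p) =
    trans (cong (_+_ (+ 2)) (twosOnes-sum j a b m p))
          (sym (ℤₚ.+-assoc (+ 2) (+ (j ℕ.* 2 ℕ.+ a)) (- + b)))
  twosOnes-sum zero    (suc a) b       (suc m) (s≤s p) =
    trans (cong (_+_ (+ 1)) (twosOnes-sum zero a b m p))
          (sym (ℤₚ.+-assoc (+ 1) (+ a) (- + b)))
  twosOnes-sum zero    zero    (suc b) (suc m) (s≤s p) =
    trans (cong (_+_ -[1+ 0 ]) (twosOnes-sum zero zero b m p)) (one-more-minus (+ b))
    where
    one-more-minus : ∀ B → -[1+ 0 ] + (+ 0 - B) ≡ + 0 - (+ 1 + B)
    one-more-minus = solve-∀

  twosOnes-sumSq : ∀ j a b m → j ℕ.+ a ℕ.+ b ℕ.≤ m →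
                   sumSqℤ (twosOnes j a b m) ≡ + (j ℕ.* 4 ℕ.+ a ℕ.+ b)
  twosOnes-sumSq zero    zero    zero    zero    _       = refl
  twosOnes-sumSq zero    zero    zero    (suc m) _       =
    cong (_+_ (+ 0)) (twosOnes-sumSq zero zero zero m z≤n)
  twosOnes-sumSq (suc j) a       b       (suc m) (s≤s p) =
    cong (_+_ (+ 4)) (twosOnes-sumSq j a b m p)
  twosOnes-sumSq zero    (suc a) b       (suc m) (s≤s p) =
    cong (_+_ (+ 1)) (twosOnes-sumSq zero a b m p)
  twosOnes-sumSq zero    zero    (suc b) (suc m) (s≤s p) =
    cong (_+_ (+ 1)) (twosOnes-sumSq zero zero b m p)

  twosOnes-InS : ∀ {m} j a b t → j ℕ.+ a ℕ.+ b ℕ.≤ m → t ℕ.+ b ≡ j ℕ.* 2 ℕ.+ a →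
                 InS m (j ℕ.* 4 ℕ.+ a ℕ.+ b) (+ t)
  twosOnes-InS {m} j a b t fits balance =
    twosOnes j a b m ,
    trans (twosOnes-sum j a b m fits)
          (trans (cong (λ s → + s - + b) (sym balance)) (add-sub (+ t) (+ b))) ,
    twosOnes-sumSq j a b m fits
    where
    add-sub : ∀ x y → (x + y) - y ≡ x
    add-sub = solve-∀

  neg-square : ∀ x → (- x) * (- x) ≡ x * x
  neg-square = solve-∀

  sum-neg : ∀ {m} (v : Vector ℤ m) → sumℤ (map -_ v) ≡ - sumℤ v
  sum-neg {zero}  v = refl
  sum-neg {suc m} v = trans (cong (_+_ (- head v)) (sum-neg (tail v)))
                            (sym (ℤₚ.neg-distrib-+ (head v) (sumℤ (tail v))))

  sumSq-neg : ∀ {m} (v : Vector ℤ m) → sumSqℤ (map -_ v) ≡ sumSqℤ v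
  sumSq-neg {zero}  v = refl
  sumSq-neg {suc m} v = cong₂ _+_ (neg-square (head v)) (sumSq-neg (tail v))

  InS-neg : ∀ {m n T} → InS m n T → InS m n (- T)
  InS-neg (v , sum≡T , sumSq≡n) =
    map -_ v , trans (sum-neg v) (cong -_ sum≡T) , trans (sumSq-neg v) sumSq≡n

  square-parity : ∀ x → + 2 ∣ₛ x - x * x
  square-parity x with x % + 2 | n%d<d x (+ 2) | a≡a%n+[a/n]*n x (+ 2)
  ... | 0 | _ | x≡2q = divides (q - q * q * + 2) (trans (cong (λ z → z - z * z) x≡2q) (even q))
    where
    q : ℤ
    q = x / + 2
    even : ∀ q → (+ 0 + q * + 2) - (+ 0 + q * + 2) * (+ 0 + q * + 2) ≡ (q - q * q * + 2) * + 2
    even = solve-∀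
  ... | 1 | _ | x≡1+2q = divides (- q - q * q * + 2) (trans (cong (λ z → z - z * z) x≡1+2q) (odd q))
    where
    q : ℤ
    q = x / + 2
    odd : ∀ q → (+ 1 + q * + 2) - (+ 1 + q * + 2) * (+ 1 + q * + 2) ≡ (- q - q * q * + 2) * + 2
    odd = solve-∀
  ... | suc (suc _) | s≤s (s≤s ()) | _

  sum-parity : ∀ {m} (v : Vector ℤ m) → + 2 ∣ₛ sumℤ v - sumSqℤ v
  sum-parity {zero}  v = divides (+ 0) refl
  sum-parity {suc m} v =
    subst (+ 2 ∣ₛ_) (sym (regroup (head v) (sumℤ (tail v)) (sumSqℤ (tail v))))
          (∣m∣n⇒∣m+n (square-parity (head v)) (sum-parity (tail v)))
    where
    regroup : ∀ x s q → (x + s) - (x * x + q) ≡ (x - x * x) + (s - q)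
    regroup = solve-∀

  InS-parity : ∀ {m n T} → InS m n T → + 2 Unsigned.∣ T - + n
  InS-parity (v , sum≡T , sumSq≡n) =
    ∣⇒∣ᵤ (subst (+ 2 ∣ₛ_) (cong₂ _-_ sum≡T sumSq≡n) (sum-parity v))

  InT-neg : ∀ {m n T} → InT m n T → InT m n (- T)
  InT-neg {m} {n} {T} (2∣T-n , T²<mn) =
    ∣⇒∣ᵤ (subst (+ 2 ∣ₛ_) (sym (reflect T (+ n)))
                 (∣m∣n⇒∣m+n (∣m⇒∣-m (∣ᵤ⇒∣ {+ 2} {T - + n} 2∣T-n)) (∣n⇒∣m*n (- + n) ∣-refl))) ,
    subst (_< + m * + n) (sym (neg-square T)) T²<mn
    where
    reflect : ∀ x y → - x - y ≡ - (x - y) + (- y) * + 2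
    reflect = solve-∀

  ∣t-[t+d]∣≡d : ∀ t d → ∣ + t - + (t ℕ.+ d) ∣ ≡ d
  ∣t-[t+d]∣≡d t d = begin
    ∣ + t - + (t ℕ.+ d) ∣ ≡⟨ cong ∣_∣ (ℤₚ.[+m]-[+n]≡m⊖n t (t ℕ.+ d)) ⟩
    ∣ t ⊖ (t ℕ.+ d) ∣     ≡⟨ ℤₚ.∣⊖∣-≤ (ℕₚ.m≤m+n t d) ⟩
    (t ℕ.+ d) ℕ.∸ t       ≡⟨ ℕₚ.m+n∸m≡n t d ⟩
    d                     ∎
    where open ≡-Reasoning

  square-<⇒ℤ : ∀ t m n → t ℕ.* t ℕ.< m ℕ.* n → + t * + t < + m * + n
  square-<⇒ℤ t m n lt = subst₂ _<_ (ℤₚ.pos-* t t) (ℤₚ.pos-* m n) (+<+ lt)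

  square-<⇒ℕ : ∀ t m n → + t * + t < + m * + n → t ℕ.* t ℕ.< m ℕ.* n
  square-<⇒ℕ t m n lt =
    ℤₚ.drop‿+<+ (subst₂ _<_ (sym (ℤₚ.pos-* t t)) (sym (ℤₚ.pos-* m n)) lt)

  square-below : ∀ {m n t} → m ℕ.≤ n → t ℕ.* t ℕ.< m ℕ.* n → t ℕ.≤ n
  square-below {m} {n} {t} m≤n t²<mn with ℕₚ.≤-total t n
  ... | inj₁ t≤n = t≤n
  ... | inj₂ n≤t = ⊥-elim (ℕₚ.<⇒≱ t²<mn
                     (ℕₚ.≤-trans (ℕₚ.*-monoˡ-≤ n m≤n) (ℕₚ.*-mono-≤ n≤t n≤t)))

  InT⇒gap : ∀ {m n} t → m ℕ.≤ n → InT m n (+ t) →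
            Σ ℕ λ w → (t ℕ.+ w ℕ.* 2 ≡ n) × (t ℕ.* t ℕ.< m ℕ.* n)
  InT⇒gap {m} {n} t m≤n (Unsigned.divides w gap≡2w , lt)
    with ℕₚ.m≤n⇒∃[o]m+o≡n {m = t} (square-below m≤n (square-<⇒ℕ t m n lt))
  ... | d , refl = w , cong (t ℕ.+_) (trans (sym gap≡2w) (∣t-[t+d]∣≡d t d)) , square-<⇒ℕ t m n lt

  gap⇒InT : ∀ {m n} t w → t ℕ.+ w ℕ.* 2 ≡ n → t ℕ.* t ℕ.< m ℕ.* n → InT m n (+ t)
  gap⇒InT {m} t w refl lt = Unsigned.divides w (∣t-[t+d]∣≡d t (w ℕ.* 2)) , square-<⇒ℤ t m _ lt

  Full⁺ : ℕ → ℕ → Set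
  Full⁺ m n = ∀ t w → t ℕ.+ w ℕ.* 2 ≡ n → t ℕ.* t ℕ.< m ℕ.* n → InS m n (+ t)

  -- By parity and symmetry, this suffices for fullness.
  full-from-nonneg : ∀ {m n} → m ℕ.≤ n → Full⁺ m n → Full m n
  full-from-nonneg {m} {n} m≤n realize T =
    mk⇔ (λ (T∈S , lt) → InS-parity T∈S , lt) (λ T∈T → realizeT T T∈T , proj₂ T∈T)
    where
    realize⁺ : ∀ t → InT m n (+ t) → InS m n (+ t)
    realize⁺ t t∈T with InT⇒gap t m≤n t∈T
    ... | w , t+2w≡n , lt = realize t w t+2w≡n lt

    realizeT : ∀ T → InT m n T → InS m n T
    realizeT (+ t)     T∈T = realize⁺ t T∈T
    realizeT -[1+ t ]  T∈T = InS-neg (realize⁺ (suc t) (InT-neg {m} {n} { -[1+ t ]} T∈T))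

  -- Every integer satisfies 3x ≤ x² + 2, since (x - 1)(x - 2) ≥ 0.
  three-bound : ∀ x → + 3 * x ≤ x * x + + 2
  three-bound (+ 0)             = +≤+ z≤n
  three-bound (+ 1)             = +≤+ ℕₚ.≤-refl
  three-bound (+ suc (suc k))   =
    +≤+ (subst (3 ℕ.* suc (suc k) ℕ.≤_) (sym (expand k)) (ℕₚ.m≤m+n _ _))
    where
    expand : ∀ k → (2 ℕ.+ k) ℕ.* (2 ℕ.+ k) ℕ.+ 2 ≡ 3 ℕ.* (2 ℕ.+ k) ℕ.+ (k ℕ.+ k ℕ.* k)
    expand = ℕ-Solver.solve-∀
  three-bound -[1+ k ]          = -≤+

  sum-three-bound : ∀ {m} (v : Vector ℤ m) → + 3 * sumℤ v ≤ sumSqℤ v + + (m ℕ.* 2)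
  sum-three-bound {zero}  v = +≤+ z≤n
  sum-three-bound {suc m} v = begin
    + 3 * (x + s)                    ≡⟨ ℤₚ.*-distribˡ-+ (+ 3) x s ⟩
    + 3 * x + + 3 * s                ≤⟨ ℤₚ.+-mono-≤ (three-bound x) (sum-three-bound (tail v)) ⟩
    (x * x + + 2) + (q + + (m ℕ.* 2)) ≡⟨ regroup (x * x) q (+ (m ℕ.* 2)) ⟩
    (x * x + q) + (+ 2 + + (m ℕ.* 2)) ∎
    where
    open ℤₚ.≤-Reasoning
    x = head v
    s = sumℤ (tail v)
    q = sumSqℤ (tail v)
    regroup : ∀ a b c → (a + + 2) + (b + c) ≡ (a + b) + (+ 2 + c)
    regroup = solve-∀

  InS-three-bound : ∀ {m n} t → InS m n (+ t) → 3 ℕ.* t ℕ.≤ n ℕ.+ m ℕ.* 2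
  InS-three-bound {m} {n} t (v , sum≡t , sumSq≡n) =
    ℤₚ.drop‿+≤+ (subst₂ _≤_ (trans (cong (+ 3 *_) sum≡t) (sym (ℤₚ.pos-* 3 t)))
                             (cong (_+ + (m ℕ.* 2)) sumSq≡n)
                             (sum-three-bound v))

  not-full : ∀ {m n} t w → t ℕ.+ w ℕ.* 2 ≡ n → t ℕ.* t ℕ.< m ℕ.* n →
             n ℕ.+ m ℕ.* 2 ℕ.< 3 ℕ.* t → ¬ Full m n
  not-full {m} {n} t w t+2w≡n lt beyond full =
    ℕₚ.<⇒≱ beyond (InS-three-bound {m} {n} t t∈S)
    where
    t∈S : InS m n (+ t)
    t∈S = proj₁ (Equivalence.from (full (+ t)) (gap⇒InT {m} t w t+2w≡n lt))

open import Defs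
open import Data.Nat using (ℕ; zero; suc; _≤_; _<_; _+_; _*_; s≤s; _≤?_; _<?_)
open import Data.Nat.Properties
  using (≤-trans; ≤-pred; <⇒≤; <⇒≱; ≰⇒>; *-mono-≤; *-monoˡ-≤; +-monoʳ-≤;
         +-cancelʳ-≤; +-cancelˡ-≤; *-cancelʳ-<; m≤m+n; m≤n+m; n<1+n; n≤1+n; +-identityʳ;
         +-assoc; +-suc; m≤n⇒∃[o]m+o≡n)
open import Data.Nat.Tactic.RingSolver using (solve; solve-∀)
open import Data.Integer using (+_; -[1+_])
open import Data.List using (_∷_; [])
import Data.Vec.Functional as Vector
open import Data.Product using (_×_; _,_; proj₁; proj₂)
open import Relation.Nullary using (¬_; Dec; yes; no)
open import Relation.Nullary.Decidable using (from-yes)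
open import Relation.Binary.PropositionalEquality using (_≡_; refl; sym; trans; cong; subst; subst₂; module ≡-Reasoning)
open IntegerVectors using (twosOnes-InS; Full⁺; full-from-nonneg; not-full)

-- A target t with n = t + 2w is realized by j twos when j ≤ w, 3j ≤ t + w and
-- n ≤ m + 3j: take b = w - j minus ones and a = t + w - 3j ones.
twos-realize : ∀ {m n} j t w → t + w * 2 ≡ n → n ≤ m + j * 3 → j ≤ w → j * 3 ≤ t + w →
               InS m n (+ t)
twos-realize {m} j t w refl room j≤w 3j≤t+w with m≤n⇒∃[o]m+o≡n j≤w
... | b , refl with m≤n⇒∃[o]m+o≡n 2j≤t+b
  where
  2j≤t+b : j * 2 ≤ t + b
  2j≤t+b = +-cancelʳ-≤ j (j * 2) (t + b) (subst₂ _≤_ 3j≡2j+j t+[j+b]≡[t+b]+j 3j≤t+w)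
    where
    3j≡2j+j : j * 3 ≡ j * 2 + j
    3j≡2j+j = solve (j ∷ [])
    t+[j+b]≡[t+b]+j : t + (j + b) ≡ t + b + j
    t+[j+b]≡[t+b]+j = solve (t ∷ j ∷ b ∷ [])
... | a , 2j+a≡t+b =
  subst (λ n → InS m n (+ t)) square-sum (twosOnes-InS j a b t fits (sym 2j+a≡t+b))
  where
  open ≡-Reasoning
  square-sum : j * 4 + a + b ≡ t + (j + b) * 2
  square-sum = begin
    j * 4 + a + b             ≡⟨ solve (j ∷ a ∷ b ∷ []) ⟩
    (j * 2 + a) + (j * 2 + b) ≡⟨ cong (_+ (j * 2 + b)) 2j+a≡t+b ⟩
    (t + b) + (j * 2 + b)     ≡⟨ solve (t ∷ j ∷ b ∷ []) ⟩
    t + (j + b) * 2           ∎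
  fits : j + a + b ≤ m
  fits = +-cancelʳ-≤ (j * 3) (j + a + b) m (subst (_≤ m + j * 3) nonzero-count room)
    where
    nonzero-count : t + (j + b) * 2 ≡ j + a + b + j * 3
    nonzero-count = trans (sym square-sum) (solve (j ∷ a ∷ b ∷ []))

top-excluded : ∀ {m n t w} i c → c + i * 2 ≡ n → m * n ≤ c * c →
               t + w * 2 ≡ n → t * t < m * n → i < w
top-excluded {m} {n} {t} {w} i c c+2i≡n mn≤c² t+2w≡n t²<mn =
  ≰⇒> λ w≤i → <⇒≱ t²<mn (≤-trans mn≤c² (*-mono-≤ (c≤t w≤i) (c≤t w≤i)))
  where
  open Data.Nat.Properties.≤-Reasoning
  c≤t : w ≤ i → c ≤ t
  c≤t w≤i = +-cancelʳ-≤ (i * 2) c t (begin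
    c + i * 2 ≡⟨ trans c+2i≡n (sym t+2w≡n) ⟩
    t + w * 2 ≤⟨ +-monoʳ-≤ t (*-monoˡ-≤ 2 w≤i) ⟩
    t + i * 2 ∎)

-- Halving: if t + 2w = n and 2k ≤ t + n + 1 then k ≤ t + w, as 2(t + w) = t + n.
halve : ∀ {n t w} k → t + w * 2 ≡ n → k * 2 ≤ suc (t + n) → k ≤ t + w
halve {n} {t} {w} k t+2w≡n 2k≤1+t+n = ≤-pred (*-cancelʳ-< 2 k (suc (t + w)) (begin-strict
  k * 2                   ≤⟨ 2k≤1+t+n ⟩
  suc (t + n)             <⟨ n<1+n _ ⟩
  suc (suc (t + n))       ≡⟨ cong (λ x → suc (suc (t + x))) (sym t+2w≡n) ⟩
  suc (suc (t + (t + w * 2))) ≡⟨ double t w ⟩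
  suc (t + w) * 2         ∎))
  where
  open Data.Nat.Properties.≤-Reasoning
  double : ∀ t w → suc (suc (t + (t + w * 2))) ≡ suc (t + w) * 2
  double = solve-∀

twos-target : ∀ {m n t w} i c → c + i * 2 ≡ n → m * n ≤ c * c → n ≤ m + suc i * 3 →
              suc i * 3 * 2 ≤ suc (t + n) → t + w * 2 ≡ n → t * t < m * n → InS m n (+ t)
twos-target {m} {n} {t} {w} i c c+2i≡n mn≤c² room low t+2w≡n t²<mn =
  twos-realize (suc i) t w t+2w≡n room (top-excluded {m} {n} {t} {w} i c c+2i≡n mn≤c² t+2w≡n t²<mn)
               (halve (suc i * 3) t+2w≡n low)

twos-full⁺ : ∀ {m n} i c → c + i * 2 ≡ n → m * n ≤ c * c → n ≤ m + suc i * 3 →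
             suc i * 3 * 2 ≤ suc n → Full⁺ m n
twos-full⁺ {m} {n} i c c+2i≡n mn≤c² room low t w =
  twos-target {m} {n} {t} {w} i c c+2i≡n mn≤c² room (≤-trans low (s≤s (m≤n+m n t)))

full-near : ∀ {m n} → m ≤ n → n ≤ m + 3 → 5 ≤ n → Full m n
full-near {m} {n} m≤n room 5≤n =
  full-from-nonneg m≤n (twos-full⁺ 0 n (+-identityʳ n) (*-monoˡ-≤ n m≤n) room (s≤s 5≤n))

full-far : ∀ {m n} → m + 4 ≤ n → n ≤ m + 6 → 11 ≤ n → Full m n
full-far {m} m+4≤n room 11≤n with m≤n⇒∃[o]m+o≡n m+4≤n
... | k , refl =
  full-from-nonneg (≤-trans (m≤m+n m 4) m+4≤n)
                   (twos-full⁺ 1 (m + 2 + k) c+2≡n mn≤c² room (s≤s 11≤n))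
  where
  c+2≡n : m + 2 + k + 1 * 2 ≡ m + 4 + k
  c+2≡n = solve (m ∷ k ∷ [])
  c²≡mn+excess : (m + 2 + k) * (m + 2 + k) ≡ m * (m + 4 + k) + (4 + 4 * k + k * k + m * k)
  c²≡mn+excess = solve (m ∷ k ∷ [])
  mn≤c² : m * (m + 4 + k) ≤ (m + 2 + k) * (m + 2 + k)
  mn≤c² = subst (m * (m + 4 + k) ≤_) (sym c²≡mn+excess) (m≤m+n _ _)

full-large : ∀ m → 10 ≤ m → ∀ n → m < n → n ≤ m + 6 → Full m n
full-large m 10≤m n m<n n≤m+6 = by-range (n ≤? m + 3)
  where
  11≤n : 11 ≤ n
  11≤n = ≤-trans (s≤s 10≤m) m<n
  by-range : Dec (n ≤ m + 3) → Full m n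
  by-range (yes n≤m+3) = full-near (<⇒≤ m<n) n≤m+3 (≤-trans (from-yes (5 ≤? 11)) 11≤n)
  by-range (no  n≰m+3) = full-far (subst (_≤ n) (sym (+-suc m 3)) (≰⇒> n≰m+3)) n≤m+6 11≤n

full-nine-sixteen : Full 9 16
full-nine-sixteen = full-from-nonneg (from-yes (9 ≤? 16)) realize
  where
  realize : Full⁺ 9 16
  realize zero    w _ _ =
    (+ 2 Vector.∷ + 2 Vector.∷ -[1+ 1 ] Vector.∷ -[1+ 1 ] Vector.∷ Vector.replicate 5 (+ 0)) ,
    refl , refl
  realize (suc t) w t+2w≡16 t²<144 =
    twos-target {9} {16} {suc t} {w} 2 12 refl (from-yes (9 * 16 ≤? 12 * 12)) (from-yes (16 ≤? 18))
                (s≤s (s≤s (m≤n+m 16 t))) t+2w≡16 t²<144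

full-nine-top : ∀ k → k ≤ 2 → Full 9 (16 + k)
full-nine-top 0 _ = full-nine-sixteen
full-nine-top 1 _ =
  full-from-nonneg (from-yes (9 ≤? 17))
    (twos-full⁺ {9} {17} 2 13 refl (from-yes (9 * 17 ≤? 13 * 13)) (from-yes (17 ≤? 18)) (from-yes (18 ≤? 18)))
full-nine-top 2 _ =
  full-from-nonneg (from-yes (9 ≤? 18))
    (twos-full⁺ {9} {18} 2 14 refl (from-yes (9 * 18 ≤? 14 * 14)) (from-yes (18 ≤? 18)) (from-yes (18 ≤? 19)))
full-nine-top (suc (suc (suc k))) (s≤s (s≤s ()))

full-nine : ∀ n → 10 ≤ n → n ≤ 18 → Full 9 n
full-nine n 10≤n n≤18 = by-range (n ≤? 12) (n ≤? 15)
  where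
  by-range : Dec (n ≤ 12) → Dec (n ≤ 15) → Full 9 n
  by-range (yes n≤12) _          =
    full-near {9} {n} (≤-trans (from-yes (9 ≤? 10)) 10≤n) n≤12 (≤-trans (from-yes (5 ≤? 10)) 10≤n)
  by-range (no  n≰12) (yes n≤15) =
    full-far {9} {n} (≰⇒> n≰12) n≤15 (≤-trans (from-yes (11 ≤? 13)) (≰⇒> n≰12))
  by-range (no  _)    (no  n≰15) =
    subst (Full 9) 16+k≡n (full-nine-top k (+-cancelˡ-≤ 16 k 2 (subst (_≤ 18) (sym 16+k≡n) n≤18)))
    where
    k : ℕ
    k = proj₁ (m≤n⇒∃[o]m+o≡n (≰⇒> n≰15))
    16+k≡n : 16 + k ≡ n
    16+k≡n = proj₂ (m≤n⇒∃[o]m+o≡n (≰⇒> n≰15))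

not-full-nine : ¬ Full 9 19
not-full-nine = not-full {9} {19} 13 3 refl (from-yes (13 * 13 <? 9 * 19)) (from-yes (19 + 9 * 2 <? 3 * 13))

-- Part (ii), failure: m + 3 ∈ 𝒯_m(m + 7), as m(m + 7) - (m + 3)² = m - 9 > 0,
-- but 3(m + 3) > (m + 7) + 2m.
not-full-large : ∀ m → 10 ≤ m → ¬ Full m (m + 7)
not-full-large m 10≤m with m≤n⇒∃[o]m+o≡n 10≤m
... | k , refl = not-full {m} {m + 7} (m + 3) 2 (+-assoc m 3 4) below beyond
  where
  below : (m + 3) * (m + 3) < m * (m + 7)
  below = subst (suc ((m + 3) * (m + 3)) ≤_) (gap k) (m≤m+n _ k)
    where
    gap : ∀ k → suc ((10 + k + 3) * (10 + k + 3)) + k ≡ (10 + k) * (10 + k + 7)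
    gap = solve-∀
  beyond : m + 7 + m * 2 < 3 * (m + 3)
  beyond = subst (m + 7 + m * 2 <_) (sym (triple m)) (n≤1+n _)
    where
    triple : ∀ m → 3 * (m + 3) ≡ suc (suc (m + 7 + m * 2))
    triple = solve-∀

corollary4p12 :
    (((n : ℕ) → 10 ≤ n → n ≤ 18 → Full 9 n) × ¬ Full 9 19)
    × ((m : ℕ) → 10 ≤ m →
        ((n : ℕ) → m < n → n ≤ m + 6 → Full m n) × ¬ Full m (m + 7))
corollary4p12 =
  (full-nine , not-full-nine) , λ m 10≤m → full-large m 10≤m , not-full-large m 10≤m
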